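{- For every prime $p$ and all $k,n\in\mathbb N$, $$A(n,p^k)=\binom{n+k-2}{n-1}\,\varphi(p^k)^n.$$
   Context: Let $\chi:\mathbb Q\to\mathbb Q$ be defined by $\chi(x)=x\lceil x\rceil$, where $\lceil x\rceil$ is the smallest integer greater than or equal to $x$. For $x\in\mathbb Q$, $\mathrm{ord}(x)=\min\{k\in\mathbb N_0:\chi^k(x)\in\mathbb Z\}$ if this set is nonempty, and $\mathrm{ord}(x)=\infty$ otherwise ($\mathbb N=\{1,2,\dots\}$, $\mathbb N_0=\mathbb N\cup\{0\}$). For $n\in\mathbb N_0$ and $M\in\mathbb N$, let $\mathcal A_{n,M}=\{a\in\mathbb Z:\gcd(a,M)=1,\ \mathrm{ord}(a/M)=n\}$; this set is a union of congruence classes modulo $M^{n+1}$, and $A(n,M)$ denotes the number of congruence classes modulo $M^{n+1}$ contained in $\mathcal A_{n,M}$. $\varphi$ is Euler's totient function. -}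

module Defs where

open import Data.Nat as ℕ using (ℕ; zero; suc; _^_)
open import Data.Nat.Coprimality using (Coprime; coprime?)
open import Data.Integer as ℤ using (ℤ; +_)
open import Data.Rational as ℚ using (ℚ; ceiling; _/_)
open import Data.Fin using (Fin; toℕ)
open import Data.Fin.Properties using (all?)
open import Data.List using (List; length; filter; upTo)
open import Data.Product using (_×_)
open import Relation.Nullary using (Dec; ¬_; _×-dec_; ¬?)
open import Relation.Binary.PropositionalEquality using (_≡_)

χ : ℚ → ℚ
χ x = x ℚ.* (ceiling x / 1)

χ^ : ℕ → ℚ → ℚ
χ^ zero x = x
χ^ (suc k) x = χ (χ^ k x)

IsInt : ℚ → Set
IsInt x = ℚ.denominatorℕ x ≡ 1

isInt? : (x : ℚ) → Dec (IsInt x)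
isInt? x = ℚ.denominatorℕ x ℕ.≟ 1

OrdIs : ℚ → ℕ → Set
OrdIs x n = IsInt (χ^ n x) × (∀ (j : Fin n) → ¬ IsInt (χ^ (toℕ j) x))

ordIs? : (x : ℚ) (n : ℕ) → Dec (OrdIs x n)
ordIs? x n = isInt? (χ^ n x) ×-dec all? (λ j → ¬? (isInt? (χ^ (toℕ j) x)))

-- membership of a in 𝒜_{n,M} for M = suc m
InA : ℕ → ℕ → ℕ → Set
InA n m a = Coprime a (suc m) × OrdIs ((+ a) / suc m) n

inA? : ∀ n m a → Dec (InA n m a)
inA? n m a = coprime? a (suc m) ×-dec ordIs? ((+ a) / suc m) n

-- A(n,M): number of residue classes a mod M^{n+1} (representatives
-- 0 ≤ a < M^{n+1}) lying in 𝒜_{n,M}.  M = 0 is not in ℕ = {1,2,...}; junk value 0.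
A : ℕ → ℕ → ℕ
A n zero = 0
A n (suc m) = length (filter (inA? n m) (upTo (suc m ^ suc n)))

φ : ℕ → ℕ
φ m = length (filter (λ a → coprime? (suc a) m) (upTo m))

-- For x = a/M one has χ(a/M) = a⌈a/M⌉/M, so ord(a/M) is read off the orbit of the integer map
-- a ↦ a⌈a/M⌉, and whether ord(a/M) = n depends only on a mod M^(n+1).  If a = qM + r with r a unit
-- mod M, then a⌈a/M⌉ = (qM + r)(q + 1), and q ↦ (qM + r)(q + 1) permutes the residues mod M^(n+1)
-- because its increments are d times a unit.  Hence A(n+1, M) = φ(M)·T(n, M), where T(n, M) counts
-- all residues mod M^(n+1) of order n, units or not.  For M = p^(k+1) the non-units are the p·y,
-- with ord(p·y/M) = ord(y/p^k) and y running over p^n periods mod p^(k(n+1)), so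
-- T(n, p^(k+1)) = A(n, p^(k+1)) + p^n·T(n, p^k).  With T(0, M) = 1, T(n+1, 1) = 0 and
-- φ(p^(k+2)) = p·φ(p^(k+1)), Pascal's rule solves this recursion: T(n, p^k) = C(n+k-1, n)·φ(p^k)^n.

module Submission where

open import Defs
open import Data.Nat using (ℕ; _+_; _∸_; _*_; _^_; _≤_)
open import Data.Nat.Primality using (Prime)
open import Data.Nat.Combinatorics using (_C_)
open import Relation.Binary.PropositionalEquality using (_≡_)

import Algebra.Properties.CommutativeSemigroup as CommutativeSemigroupProperties
open import Data.Fin using (Fin; toℕ; fromℕ<; punchOut) renaming (zero to fzero; suc to fsuc)
import Data.Fin.Properties as Fin
open import Data.Fin.Properties
  using (toℕ<n; toℕ-inject₁; toℕ-fromℕ; toℕ-fromℕ<; toℕ-injective; punchOut-injective; injective⇒≤; any?)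
open import Data.Fin.Permutation using (Permutation)
open import Data.Integer as ℤ using (ℤ)
import Data.Integer.Properties as ℤ
open import Data.List using (_∷_; length; filter; applyUpTo)
open import Data.Nat
  using (zero; suc; _<_; NonZero; ≢-nonZero; ≢-nonZero⁻¹; >-nonZero⁻¹; nonTrivial⇒n>1;
         z≤n; z<s; s≤s; s<s; s≤s⁻¹)
open import Data.Nat.Properties
open import Data.Nat.Combinatorics using (nCk+nC[k+1]≡[n+1]C[k+1]; k>n⇒nCk≡0)
open import Data.Nat.Coprimality as Coprime using (Coprime; coprime?; coprime-divisor)
import Data.Nat.DivMod as ℕ
open import Data.Nat.DivMod using (_%_; m≡m%n+[m/n]*n; m%n<n; m*[n/m]≡n; m/n*n≡m; n/n≡1)
open import Data.Nat.Divisibility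
  using (_∣_; _∣?_; _∣0; divides; ∣-refl; ∣-trans; ∣-antisym; ∣1⇒≡1; ∣⇒≤; m∣m*n; n∣m*n;
         ∣n⇒∣m*n; ∣m+n∣m⇒∣n; ∣m∣n⇒∣m+n; *-monoʳ-∣; *-cancelˡ-∣)
open import Data.Nat.GCD using (gcd; gcd[m,n]≢0; n/gcd[m,n]≢0; gcd[m,n]∣m; gcd[m,n]∣n; gcd-greatest)
open import Data.Nat.Primality using (prime⇒nonZero; prime⇒nonTrivial; prime⇒irreducible)
open import Data.Nat.Tactic.RingSolver using (solve-∀)
open import Data.Product using (_×_; _,_; proj₁; proj₂; ∃)
open import Data.Product.Function.NonDependent.Propositional using (_×-⇔_)
import Data.Rational as ℚ
open import Data.Rational using (ℚ; mkℚ; _/_; ↥_; ↧ₙ_; toℚᵘ; fromℚᵘ)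
import Data.Rational.Properties as ℚ
open import Data.Rational.Unnormalised using (mkℚᵘ)
import Data.Rational.Unnormalised.Properties as ℚᵘ
open import Data.Sum using (inj₁; inj₂)
open import Function using (_∘_; _⇔_; mk⇔; Equivalence)
open import Function.Bundles using (mk⤖)
open import Function.Properties.Bijection using (⤖⇒↔)
import Function.Properties.Equivalence as ⇔
open import Function.Related.TypeIsomorphisms using (→-cong-⇔)
open import Relation.Nullary using (Dec; yes; no; ¬_; ¬?; _×-dec_)
open import Relation.Nullary.Negation using (contradiction)
open import Relation.Unary using (Pred; Decidable)
open import Relation.Binary.PropositionalEquality
  using (refl; sym; trans; cong; cong₂; subst; subst₂; module ≡-Reasoning)
open import Algebra.Properties.Semiring.Sum +-*-semiring
  using (sum; sum-cong-≗; sum-init-last; sum-replicate-zero; ∑-distrib-+; ∑-comm; *-distribʳ-sum;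
         sum-permute)

private
  module +-CS = CommutativeSemigroupProperties +-commutativeSemigroup
  module *-CS = CommutativeSemigroupProperties *-commutativeSemigroup

𝟙 : ∀ {P : Set} → Dec P → ℕ
𝟙 (yes _) = 1
𝟙 (no _) = 0

𝟙-cong : ∀ {P Q : Set} (p : Dec P) (q : Dec Q) → P ⇔ Q → 𝟙 p ≡ 𝟙 q
𝟙-cong (yes _) (yes _) _ = refl
𝟙-cong (yes a) (no ¬b) P⇔Q = contradiction (Equivalence.to P⇔Q a) ¬b
𝟙-cong (no ¬a) (yes b) P⇔Q = contradiction (Equivalence.from P⇔Q b) ¬a
𝟙-cong (no _) (no _) _ = refl

𝟙-yes : ∀ {P : Set} (p : Dec P) → P → 𝟙 p ≡ 1
𝟙-yes (yes _) _ = refl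
𝟙-yes (no ¬a) a = contradiction a ¬a

𝟙-no : ∀ {P : Set} (p : Dec P) → ¬ P → 𝟙 p ≡ 0
𝟙-no (yes a) ¬a = contradiction a ¬a
𝟙-no (no _) _ = refl

𝟙-split : ∀ {P Q : Set} (p : Dec P) (q : Dec Q) → 𝟙 q ≡ 𝟙 (¬? p ×-dec q) + 𝟙 (p ×-dec q)
𝟙-split (yes _) (yes _) = refl
𝟙-split (yes _) (no _) = refl
𝟙-split (no _) (yes _) = refl
𝟙-split (no _) (no _) = refl

¬-cong-⇔ : ∀ {P Q : Set} → P ⇔ Q → (¬ P) ⇔ (¬ Q)
¬-cong-⇔ P⇔Q = →-cong-⇔ P⇔Q ⇔.refl

-- Pigeonhole: if y were missed, punching it out would inject Fin (suc n) into Fin n.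
injective⇒surjective : ∀ {n} (f : Fin n → Fin n) → (∀ {i j} → f i ≡ f j → i ≡ j) →
                       ∀ y → ∃ λ x → f x ≡ y
injective⇒surjective {suc n} f f-injective y with any? (λ x → f x Fin.≟ y)
... | yes hit = hit
... | no miss = contradiction (injective⇒≤ punchOut∘f-injective) 1+n≰n
  where
  punchOut∘f : Fin (suc n) → Fin n
  punchOut∘f x = punchOut {i = y} λ y≡fx → miss (x , sym y≡fx)

  punchOut∘f-injective : ∀ {i j} → punchOut∘f i ≡ punchOut∘f j → i ≡ j
  punchOut∘f-injective eq = f-injective (punchOut-injective {i = y} _ _ eq)

-- Σ< f N = f 0 + ⋯ + f (N ∸ 1), kept opaque so that it stays rigid under unification.
opaque
  Σ< : (ℕ → ℕ) → ℕ → ℕ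
  Σ< f N = sum {N} (f ∘ toℕ)

  Σ<-empty : ∀ f → Σ< f 0 ≡ 0
  Σ<-empty f = refl

  Σ<-suc : ∀ f N → Σ< f (suc N) ≡ f 0 + Σ< (f ∘ suc) N
  Σ<-suc f N = refl

  Σ<-last : ∀ f N → Σ< f (suc N) ≡ Σ< f N + f N
  Σ<-last f N = trans (sum-init-last (f ∘ toℕ))
    (cong₂ _+_ (sum-cong-≗ {N} (cong f ∘ toℕ-inject₁)) (cong f (toℕ-fromℕ N)))

  Σ<-cong : ∀ {N f g} → (∀ i → i < N → f i ≡ g i) → Σ< f N ≡ Σ< g N
  Σ<-cong f≗g = sum-cong-≗ (λ i → f≗g (toℕ i) (toℕ<n i))

  Σ<-zero : ∀ {N f} → (∀ i → i < N → f i ≡ 0) → Σ< f N ≡ 0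
  Σ<-zero {N} f≗0 = trans (Σ<-cong f≗0) (sum-replicate-zero N)

  Σ<-distrib-+ : ∀ {N} f g → Σ< (λ i → f i + g i) N ≡ Σ< f N + Σ< g N
  Σ<-distrib-+ {N} f g = ∑-distrib-+ {N} (f ∘ toℕ) (g ∘ toℕ)

  Σ<-*ʳ : ∀ {N} c f → Σ< (λ i → f i * c) N ≡ Σ< f N * c
  Σ<-*ʳ {N} c f = sym (*-distribʳ-sum {N} c (f ∘ toℕ))

  Σ<-comm : ∀ (f : ℕ → ℕ → ℕ) Q R →
            Σ< (λ q → Σ< (f q) R) Q ≡ Σ< (λ r → Σ< (λ q → f q r) Q) R
  Σ<-comm f Q R = ∑-comm {Q} {R} (λ q r → f (toℕ q) (toℕ r))

  Σ<-reindex : ∀ {N} {h : ℕ → ℕ} → (∀ i → i < N → h i < N) →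
               (∀ i j → i < N → j < N → h i ≡ h j → i ≡ j) →
               ∀ f → Σ< (f ∘ h) N ≡ Σ< f N
  Σ<-reindex {N} {h} h<N h-injective f =
    trans (sum-cong-≗ (λ i → cong f (sym (toℕ-hᶠ i)))) (sym (sum-permute (f ∘ toℕ) π))
    where
    hᶠ : Fin N → Fin N
    hᶠ i = fromℕ< (h<N (toℕ i) (toℕ<n i))

    toℕ-hᶠ : ∀ i → toℕ (hᶠ i) ≡ h (toℕ i)
    toℕ-hᶠ i = toℕ-fromℕ< (h<N (toℕ i) (toℕ<n i))

    hᶠ-injective : ∀ {i j} → hᶠ i ≡ hᶠ j → i ≡ j
    hᶠ-injective {i} {j} eq = toℕ-injective (h-injective (toℕ i) (toℕ j) (toℕ<n i) (toℕ<n j)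
      (trans (sym (toℕ-hᶠ i)) (trans (cong toℕ eq) (toℕ-hᶠ j))))

    π : Permutation N N
    π = ⤖⇒↔ (mk⤖ (hᶠ-injective , λ y → let (x , hx≡y) = injective⇒surjective hᶠ hᶠ-injective y
                                          in x , λ { refl → hx≡y }))

Σ<-≡-head : ∀ {N f} → 0 < N → (∀ i → suc i < N → f (suc i) ≡ 0) → Σ< f N ≡ f 0
Σ<-≡-head {suc N} {f} _ tail≡0 =
  trans (Σ<-suc f N) (trans (cong (f 0 +_) (Σ<-zero λ i i<N → tail≡0 i (s<s i<N))) (+-identityʳ (f 0)))

Σ<-+ : ∀ f a b → Σ< f (a + b) ≡ Σ< f a + Σ< (λ i → f (a + i)) b
Σ<-+ f zero b = cong (_+ Σ< f b) (sym (Σ<-empty f))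
Σ<-+ f (suc a) b = begin
  Σ< f (suc a + b)                   ≡⟨ Σ<-suc f (a + b) ⟩
  f 0 + Σ< (f ∘ suc) (a + b)         ≡⟨ cong (f 0 +_) (Σ<-+ (f ∘ suc) a b) ⟩
  f 0 + (Σ< (f ∘ suc) a + rest)      ≡⟨ +-assoc (f 0) _ _ ⟨
  f 0 + Σ< (f ∘ suc) a + rest        ≡⟨ cong (_+ rest) (Σ<-suc f a) ⟨
  Σ< f (suc a) + rest                ∎
  where
  open ≡-Reasoning
  rest = Σ< (λ i → f (suc a + i)) b

Σ<-blocks : ∀ f Q R → Σ< f (Q * R) ≡ Σ< (λ q → Σ< (λ r → f (q * R + r)) R) Q
Σ<-blocks f zero R = trans (Σ<-empty f) (sym (Σ<-empty _))
Σ<-blocks f (suc Q) R = begin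
  Σ< f (R + Q * R)
    ≡⟨ Σ<-+ f R (Q * R) ⟩
  Σ< f R + Σ< (λ i → f (R + i)) (Q * R)
    ≡⟨ cong (Σ< f R +_) (Σ<-blocks (λ i → f (R + i)) Q R) ⟩
  Σ< f R + Σ< (λ q → Σ< (λ r → f (R + (q * R + r))) R) Q
    ≡⟨ cong (Σ< f R +_) (Σ<-cong λ q _ → Σ<-cong λ r _ → cong f (sym (+-assoc R (q * R) r))) ⟩
  Σ< f R + Σ< (λ q → Σ< (λ r → f (suc q * R + r)) R) Q
    ≡⟨ Σ<-suc (λ q → Σ< (λ r → f (q * R + r)) R) Q ⟨
  Σ< (λ q → Σ< (λ r → f (q * R + r)) R) (suc Q)
    ∎
  where open ≡-Reasoning

Σ<-periodic : ∀ f N → (∀ x → f (x + N) ≡ f x) → ∀ Q → Σ< f (Q * N) ≡ Q * Σ< f N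
Σ<-periodic f N periodic zero = Σ<-empty f
Σ<-periodic f N periodic (suc Q) = begin
  Σ< f (N + Q * N)                          ≡⟨ Σ<-+ f N (Q * N) ⟩
  Σ< f N + Σ< (λ i → f (N + i)) (Q * N)     ≡⟨ cong (Σ< f N +_) (Σ<-cong λ i _ →
                                                  trans (cong f (+-comm N i)) (periodic i)) ⟩
  Σ< f N + Σ< f (Q * N)                     ≡⟨ cong (Σ< f N +_) (Σ<-periodic f N periodic Q) ⟩
  Σ< f N + Q * Σ< f N                       ∎
  where open ≡-Reasoning

length-filter : ∀ {P : Pred ℕ _} (P? : Decidable P) f N →
  length (filter P? (applyUpTo f N)) ≡ Σ< (λ i → 𝟙 (P? (f i))) N
length-filter P? f zero = sym (Σ<-empty _)
length-filter P? f (suc N) = begin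
  length (filter P? (f 0 ∷ xs))                   ≡⟨ length-filter-∷ (f 0) xs ⟩
  𝟙 (P? (f 0)) + length (filter P? xs)           ≡⟨ cong (𝟙 (P? (f 0)) +_) (length-filter P? (f ∘ suc) N) ⟩
  𝟙 (P? (f 0)) + Σ< (λ i → 𝟙 (P? (f (suc i)))) N ≡⟨ Σ<-suc (λ i → 𝟙 (P? (f i))) N ⟨
  Σ< (λ i → 𝟙 (P? (f i))) (suc N)                ∎
  where
  open ≡-Reasoning
  xs = applyUpTo (f ∘ suc) N
  length-filter-∷ : ∀ x xs → length (filter P? (x ∷ xs)) ≡ 𝟙 (P? x) + length (filter P? xs)
  length-filter-∷ x xs with P? x
  ... | yes _ = refl
  ... | no _ = refl

∣-shift : ∀ {d m n} k → d ∣ m → (d ∣ n + k * m) ⇔ (d ∣ n)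
∣-shift {d} {n = n} k d∣m = mk⇔
  (λ d∣n+km → ∣m+n∣m⇒∣n (subst (d ∣_) (+-comm n _) d∣n+km) d∣km)
  (λ d∣n → ∣m∣n⇒∣m+n d∣n d∣km)
  where d∣km = ∣n⇒∣m*n k d∣m

[m+n]%o≡m%o⇒o∣n : ∀ m n o .{{_ : NonZero o}} → (m + n) % o ≡ m % o → o ∣ n
[m+n]%o≡m%o⇒o∣n m n o eq = Equivalence.to (∣-shift (m ℕ./ o) ∣-refl)
  (subst (o ∣_) (sym n+[m/o]*o≡[m+n]/o*o) (n∣m*n ((m + n) ℕ./ o)))
  where
  n+[m/o]*o≡[m+n]/o*o : n + m ℕ./ o * o ≡ (m + n) ℕ./ o * o
  n+[m/o]*o≡[m+n]/o*o = +-cancelˡ-≡ (m % o) _ _ (begin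
    m % o + (n + m ℕ./ o * o)     ≡⟨ cong (m % o +_) (+-comm n _) ⟩
    m % o + (m ℕ./ o * o + n)     ≡⟨ +-assoc (m % o) _ n ⟨
    m % o + m ℕ./ o * o + n       ≡⟨ cong (_+ n) (m≡m%n+[m/n]*n m o) ⟨
    m + n                         ≡⟨ m≡m%n+[m/n]*n (m + n) o ⟩
    (m + n) % o + (m + n) ℕ./ o * o ≡⟨ cong (_+ (m + n) ℕ./ o * o) eq ⟩
    m % o + (m + n) ℕ./ o * o     ∎)
    where open ≡-Reasoning

coprime-shift : ∀ {m n} k → Coprime (k * m + n) m ⇔ Coprime n m
coprime-shift {m} {n} k = mk⇔
  (λ c {d} (d∣n , d∣m) → c (Equivalence.from (common-divisor d∣m) d∣n , d∣m))
  (λ c {d} (d∣km+n , d∣m) → c (Equivalence.to (common-divisor d∣m) d∣km+n , d∣m))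
  where
  common-divisor : ∀ {d} → d ∣ m → (d ∣ k * m + n) ⇔ (d ∣ n)
  common-divisor {d} d∣m = subst (λ x → (d ∣ x) ⇔ (d ∣ n)) (+-comm n (k * m)) (∣-shift k d∣m)

coprime-* : ∀ {d m n} → Coprime d m → Coprime d n → Coprime d (m * n)
coprime-* {d} {m} d⊥m d⊥n {e} (e∣d , e∣mn) = d⊥n (e∣d , coprime-divisor e⊥m e∣mn)
  where e⊥m : Coprime e m
        e⊥m (f∣e , f∣m) = d⊥m (∣-trans f∣e e∣d , f∣m)

coprime-^ : ∀ {d m} → Coprime d m → ∀ k → Coprime d (m ^ k)
coprime-^ d⊥m zero (_ , e∣1) = ∣1⇒≡1 e∣1
coprime-^ d⊥m (suc k) = coprime-* d⊥m (coprime-^ d⊥m k)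

^-distribʳ-* : ∀ m n o → (m * n) ^ o ≡ m ^ o * n ^ o
^-distribʳ-* m n zero = refl
^-distribʳ-* m n (suc o) =
  trans (cong (m * n *_) (^-distribʳ-* m n o)) (*-CS.interchange m n (m ^ o) (n ^ o))

-- Defined by cases on the remainder, exactly as ℚ.ceiling computes on a normalised fraction.
⌈_/_⌉ : ℕ → (M : ℕ) → .{{NonZero M}} → ℕ
⌈ zero / M ⌉ = 0
⌈ suc k / M ⌉ with suc k % M
... | zero = suc k ℕ./ M
... | suc _ = suc (suc k ℕ./ M)

module _ (M : ℕ) .{{_ : NonZero M}} where

  ⌈⌉-spec : ∀ x → x ≤ ⌈ x / M ⌉ * M × ⌈ x / M ⌉ * M < x + M
  ⌈⌉-spec zero = z≤n , >-nonZero⁻¹ M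
  ⌈⌉-spec (suc k) with suc k % M in r≡
  ... | zero = ≤-reflexive x≡ , subst (_< suc k + M) x≡ (m<m+n (suc k) (>-nonZero⁻¹ M))
    where x≡ = trans (m≡m%n+[m/n]*n (suc k) M) (cong (_+ suc k ℕ./ M * M) r≡)
  ... | suc r = ≤-trans (≤-reflexive x≡) (+-monoˡ-≤ (q * M) (<⇒≤ r<M)) , (begin-strict
      M + q * M  <⟨ +-monoʳ-< M (subst (q * M <_) (sym x≡) (m<n+m (q * M) z<s)) ⟩
      M + suc k  ≡⟨ +-comm M (suc k) ⟩
      suc k + M  ∎)
    where
    open ≤-Reasoning
    q = suc k ℕ./ M
    x≡ = trans (m≡m%n+[m/n]*n (suc k) M) (cong (_+ q * M) r≡)
    r<M = subst (_< M) r≡ (m%n<n (suc k) M)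

  ⌈⌉-unique : ∀ x c → x ≤ c * M → c * M < x + M → ⌈ x / M ⌉ ≡ c
  ⌈⌉-unique x c x≤cM cM<x+M =
    ≤-antisym (below (proj₂ (⌈⌉-spec x)) x≤cM) (below cM<x+M (proj₁ (⌈⌉-spec x)))
    where
    below : ∀ {a b} → a * M < x + M → x ≤ b * M → a ≤ b
    below {a} {b} aM<x+M x≤bM = s≤s⁻¹ (*-cancelʳ-< M a (suc b)
      (<-≤-trans aM<x+M (subst (x + M ≤_) (+-comm (b * M) M) (+-monoˡ-≤ M x≤bM))))

  ⌈⌉-shift : ∀ x t → ⌈ (x + t * M) / M ⌉ ≡ ⌈ x / M ⌉ + t
  ⌈⌉-shift x t = ⌈⌉-unique (x + t * M) (c + t)
    (subst (x + t * M ≤_) (sym (*-distribʳ-+ M c t)) (+-monoˡ-≤ (t * M) (proj₁ (⌈⌉-spec x))))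
    (subst₂ _<_ (sym (*-distribʳ-+ M c t)) (+-CS.xy∙z≈xz∙y x M (t * M))
      (+-monoˡ-< (t * M) (proj₂ (⌈⌉-spec x))))
    where c = ⌈ x / M ⌉

  ⌈⌉-block : ∀ q r → 0 < r → r ≤ M → ⌈ (q * M + r) / M ⌉ ≡ suc q
  ⌈⌉-block q r 0<r r≤M = ⌈⌉-unique (q * M + r) (suc q)
    (subst (q * M + r ≤_) (+-comm (q * M) M) (+-monoʳ-≤ (q * M) r≤M))
    (subst (_< q * M + r + M) (+-comm (q * M) M) (+-monoˡ-< M (m<m+n (q * M) 0<r)))

⌈⌉-scale : ∀ c x M .{{_ : NonZero c}} .{{_ : NonZero M}} .{{_ : NonZero (c * M)}} →
           ⌈ (c * x) / (c * M) ⌉ ≡ ⌈ x / M ⌉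
⌈⌉-scale c x M = ⌈⌉-unique (c * M) (c * x) ⌈ x / M ⌉
  (subst (c * x ≤_) (*-CS.x∙yz≈y∙xz c ⌈ x / M ⌉ M) (*-monoʳ-≤ c (proj₁ (⌈⌉-spec M x))))
  (subst₂ _<_ (*-CS.x∙yz≈y∙xz c ⌈ x / M ⌉ M) (*-distribˡ-+ c x M)
    (*-monoʳ-< c (proj₂ (⌈⌉-spec M x))))

χℕ : (M : ℕ) .{{_ : NonZero M}} → ℕ → ℕ
χℕ M x = x * ⌈ x / M ⌉

HasOrd : (M : ℕ) .{{_ : NonZero M}} → ℕ → ℕ → Set
HasOrd M zero x = M ∣ x
HasOrd M (suc n) x = ¬ M ∣ x × HasOrd M n (χℕ M x)

hasOrd? : (M : ℕ) .{{_ : NonZero M}} → ∀ n x → Dec (HasOrd M n x)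
hasOrd? M zero x = M ∣? x
hasOrd? M (suc n) x = ¬? (M ∣? x) ×-dec hasOrd? M n (χℕ M x)

module _ (M : ℕ) .{{_ : NonZero M}} where

  χℕ-shift : ∀ x t P → ∃ λ s → χℕ M (x + t * (M * P)) ≡ χℕ M x + s * P
  χℕ-shift x t P = x * t + t * M * ⌈ x / M ⌉ + t * M * t * P , (begin
    y * ⌈ y / M ⌉                 ≡⟨ cong (λ z → y * ⌈ (x + z) / M ⌉) (*-CS.x∙yz≈xz∙y t M P) ⟩
    y * ⌈ (x + t * P * M) / M ⌉   ≡⟨ cong (y *_) (⌈⌉-shift M x (t * P)) ⟩
    y * (⌈ x / M ⌉ + t * P)       ≡⟨ expand x t ⌈ x / M ⌉ M P ⟩
    χℕ M x + (x * t + t * M * ⌈ x / M ⌉ + t * M * t * P) * P  ∎)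
    where
    open ≡-Reasoning
    y = x + t * (M * P)
    expand : ∀ x t c M P →
             (x + t * (M * P)) * (c + t * P) ≡ x * c + (x * t + t * M * c + t * M * t * P) * P
    expand = solve-∀

  hasOrd-periodic : ∀ n x t → HasOrd M n (x + t * M ^ suc n) ⇔ HasOrd M n x
  hasOrd-periodic zero x t = ∣-shift t (m∣m*n 1)
  hasOrd-periodic (suc n) x t with χℕ-shift x t (M ^ suc n)
  ... | s , χℕ-shifted = ¬-cong-⇔ (∣-shift t (m∣m*n (M ^ suc n))) ×-⇔
    subst (λ y → HasOrd M n y ⇔ HasOrd M n (χℕ M x)) (sym χℕ-shifted)
      (hasOrd-periodic n (χℕ M x) s)

hasOrd-scale : ∀ c M .{{_ : NonZero c}} .{{_ : NonZero M}} .{{_ : NonZero (c * M)}} n x →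
               HasOrd (c * M) n (c * x) ⇔ HasOrd M n x
hasOrd-scale c M zero x = mk⇔ (*-cancelˡ-∣ c) (*-monoʳ-∣ c)
hasOrd-scale c M (suc n) x =
  ¬-cong-⇔ (hasOrd-scale c M zero x) ×-⇔
  subst (λ y → HasOrd (c * M) n y ⇔ HasOrd M n (χℕ M x)) (sym χℕ-scale)
    (hasOrd-scale c M n (χℕ M x))
  where
  χℕ-scale : χℕ (c * M) (c * x) ≡ c * χℕ M x
  χℕ-scale = trans (cong (c * x *_) (⌈⌉-scale c x M)) (*-assoc c x ⌈ x / M ⌉)

¬hasOrd-1 : ∀ n x → ¬ HasOrd 1 (suc n) x
¬hasOrd-1 n x (1∤x , _) = 1∤x (divides x (sym (*-identityʳ x)))

/-*-/ : ∀ i j m n .{{_ : NonZero m}} .{{_ : NonZero n}} →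
        (i / m) ℚ.* (j / n) ≡ ((i ℤ.* j) / (m * n)) {{m*n≢0 m n}}
/-*-/ i j (suc m) (suc n) = begin
  (i / suc m) ℚ.* (j / suc n)
    ≡⟨ ℚ.fromℚᵘ-toℚᵘ _ ⟨
  fromℚᵘ (toℚᵘ ((i / suc m) ℚ.* (j / suc n)))
    ≡⟨ ℚ.fromℚᵘ-cong (ℚᵘ.≃-trans (ℚ.toℚᵘ-homo-* (i / suc m) (j / suc n))
         (ℚᵘ.*-cong (ℚ.toℚᵘ-fromℚᵘ (mkℚᵘ i m)) (ℚ.toℚᵘ-fromℚᵘ (mkℚᵘ j n)))) ⟩
  (i ℤ.* j) / (suc m * suc n)
    ∎
  where open ≡-Reasoning

⌈⌉-cong : ∀ {x y M N} .{{_ : NonZero M}} .{{_ : NonZero N}} →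
          x ≡ y → M ≡ N → ⌈ x / M ⌉ ≡ ⌈ y / N ⌉
⌈⌉-cong refl refl = refl

ceiling-nonneg : ∀ q n → ↥ q ≡ ℤ.+ n → ℚ.ceiling q ≡ ℤ.+ ⌈ n / ↧ₙ q ⌉
ceiling-nonneg (mkℚ _ d-1 _) zero refl = refl
ceiling-nonneg (mkℚ _ d-1 _) (suc k) refl with suc k % suc d-1
... | zero = trans (cong ℤ.-_ (ℤ.*-identityˡ (ℤ.- (ℤ.+ (suc k ℕ./ suc d-1))))) (ℤ.neg-involutive _)
... | suc _ = cong ℤ.-_ (ℤ.*-identityˡ ℤ.-[1+ suc k ℕ./ suc d-1 ])

module _ (N M : ℕ) .{{_ : NonZero M}} where

  private
    g = gcd N M
    instance
      g≢0 : NonZero g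
      g≢0 = ≢-nonZero (gcd[m,n]≢0 N M (inj₂ (≢-nonZero⁻¹ M)))
      M/g≢0 : NonZero (M ℕ./ g)
      M/g≢0 = ≢-nonZero (n/gcd[m,n]≢0 N M)
      g*M/g≢0 : NonZero (g * (M ℕ./ g))
      g*M/g≢0 = m*n≢0 g (M ℕ./ g)
      M*1≢0 : NonZero (M * 1)
      M*1≢0 = m*n≢0 M 1

    ↥-/ : ↥ ((ℤ.+ N) / M) ≡ ℤ.+ (N ℕ./ g)
    ↥-/ = ℚ.↥-mkℚ+ (N ℕ./ g) (M ℕ./ g)

    ↧ₙ-/ : ↧ₙ ((ℤ.+ N) / M) ≡ M ℕ./ g
    ↧ₙ-/ = ℤ.+-injective (ℚ.↧-mkℚ+ (N ℕ./ g) (M ℕ./ g))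

  ceiling-/ : ℚ.ceiling ((ℤ.+ N) / M) ≡ ℤ.+ ⌈ N / M ⌉
  ceiling-/ = trans (ceiling-nonneg ((ℤ.+ N) / M) (N ℕ./ g) ↥-/) (cong ℤ.+_ (begin
    ⌈ (N ℕ./ g) / ↧ₙ ((ℤ.+ N) / M) ⌉         ≡⟨ ⌈⌉-cong {N ℕ./ g} refl ↧ₙ-/ ⟩
    ⌈ (N ℕ./ g) / (M ℕ./ g) ⌉               ≡⟨ ⌈⌉-scale g (N ℕ./ g) (M ℕ./ g) ⟨
    ⌈ (g * (N ℕ./ g)) / (g * (M ℕ./ g)) ⌉   ≡⟨ ⌈⌉-cong (m*[n/m]≡n (gcd[m,n]∣m N M))
                                                        (m*[n/m]≡n (gcd[m,n]∣n N M)) ⟩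
    ⌈ N / M ⌉                               ∎))
    where open ≡-Reasoning

  χ-/ : χ ((ℤ.+ N) / M) ≡ (ℤ.+ χℕ M N) / M
  χ-/ = begin
    (ℤ.+ N) / M ℚ.* (ℚ.ceiling ((ℤ.+ N) / M) / 1)  ≡⟨ cong (λ c → (ℤ.+ N) / M ℚ.* (c / 1)) ceiling-/ ⟩
    (ℤ.+ N) / M ℚ.* ((ℤ.+ ⌈ N / M ⌉) / 1)           ≡⟨ /-*-/ (ℤ.+ N) (ℤ.+ ⌈ N / M ⌉) M 1 ⟩
    (ℤ.+ N ℤ.* ℤ.+ ⌈ N / M ⌉) / (M * 1)             ≡⟨ ℚ./-cong (sym (ℤ.pos-* N ⌈ N / M ⌉))
                                                                 (*-identityʳ M) ⟩
    (ℤ.+ χℕ M N) / M                                ∎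
    where open ≡-Reasoning

  isInt-/ : IsInt ((ℤ.+ N) / M) ⇔ M ∣ N
  isInt-/ = mk⇔ den≡1⇒M∣N M∣N⇒den≡1
    where
    den≡1⇒M∣N : ↧ₙ ((ℤ.+ N) / M) ≡ 1 → M ∣ N
    den≡1⇒M∣N den≡1 = subst (_∣ N) g≡M (gcd[m,n]∣m N M)
      where
      open ≡-Reasoning
      g≡M : g ≡ M
      g≡M = begin
        g              ≡⟨ *-identityˡ g ⟨
        1 * g          ≡⟨ cong (_* g) (trans (sym den≡1) ↧ₙ-/) ⟩
        M ℕ./ g * g    ≡⟨ m/n*n≡m (gcd[m,n]∣n N M) ⟩
        M              ∎

    M∣N⇒den≡1 : M ∣ N → ↧ₙ ((ℤ.+ N) / M) ≡ 1
    M∣N⇒den≡1 M∣N = trans ↧ₙ-/ (trans (M/-cong g≡M) (n/n≡1 M))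
      where
      g≡M = ∣-antisym (gcd[m,n]∣n N M) (gcd-greatest M∣N ∣-refl)
      M/-cong : ∀ {a b} .{{_ : NonZero a}} .{{_ : NonZero b}} → a ≡ b → M ℕ./ a ≡ M ℕ./ b
      M/-cong refl = refl

χ^-shift : ∀ n q → χ^ (suc n) q ≡ χ^ n (χ q)
χ^-shift zero q = refl
χ^-shift (suc n) q = cong χ (χ^-shift n q)

ordIs-zero : ∀ {q} → OrdIs q 0 ⇔ IsInt q
ordIs-zero = mk⇔ (λ (int , _) → int) (λ int → int , λ ())

ordIs-suc : ∀ {q} n → OrdIs q (suc n) ⇔ (¬ IsInt q × OrdIs (χ q) n)
ordIs-suc {q} n = mk⇔
  (λ (int , ¬int) → ¬int fzero , subst IsInt (χ^-shift n q) int ,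
                    λ j → ¬int (fsuc j) ∘ subst IsInt (sym (χ^-shift (toℕ j) q)))
  (λ (¬int₀ , int , ¬int) → subst IsInt (sym (χ^-shift n q)) int , λ
    { fzero → ¬int₀
    ; (fsuc j) → ¬int j ∘ subst IsInt (χ^-shift (toℕ j) q) })

ordIs⇔hasOrd : ∀ M .{{_ : NonZero M}} n x → OrdIs ((ℤ.+ x) / M) n ⇔ HasOrd M n x
ordIs⇔hasOrd M zero x = ⇔.trans ordIs-zero (isInt-/ x M)
ordIs⇔hasOrd M (suc n) x = ⇔.trans (ordIs-suc n)
  (¬-cong-⇔ (isInt-/ x M) ×-⇔
   subst (λ q → OrdIs q n ⇔ HasOrd M n (χℕ M x)) (sym (χ-/ x M)) (ordIs⇔hasOrd M n (χℕ M x)))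

ordCount : (M : ℕ) .{{_ : NonZero M}} → ℕ → ℕ
ordCount M n = Σ< (λ x → 𝟙 (hasOrd? M n x)) (M ^ suc n)

coprimeOrdCount : (M : ℕ) .{{_ : NonZero M}} → ℕ → ℕ
coprimeOrdCount M n = Σ< (λ x → 𝟙 (coprime? x M ×-dec hasOrd? M n x)) (M ^ suc n)

A≡coprimeOrdCount : ∀ n M .{{_ : NonZero M}} → A n M ≡ coprimeOrdCount M n
A≡coprimeOrdCount n M@(suc m) = begin
  A n M                                   ≡⟨ length-filter (inA? n m) (λ a → a) (M ^ suc n) ⟩
  Σ< (λ a → 𝟙 (inA? n m a)) (M ^ suc n)  ≡⟨ Σ<-cong (λ a _ →
                                               𝟙-cong (inA? n m a) _ (⇔.refl ×-⇔ ordIs⇔hasOrd M n a)) ⟩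
  coprimeOrdCount M n                     ∎
  where open ≡-Reasoning

φ≡Σ<coprime : ∀ M → φ M ≡ Σ< (λ r → 𝟙 (coprime? r M)) M
φ≡Σ<coprime zero = sym (Σ<-empty _)
φ≡Σ<coprime M@(suc m) = begin
  φ M                             ≡⟨ length-filter (λ a → coprime? (suc a) M) (λ a → a) M ⟩
  Σ< g M                          ≡⟨ Σ<-last g m ⟩
  Σ< g m + g m                    ≡⟨ +-comm (Σ< g m) (g m) ⟩
  g m + Σ< g m                    ≡⟨ cong (_+ Σ< g m) (𝟙-cong (coprime? M M) (coprime? 0 M) M⊥M⇔0⊥M) ⟩
  𝟙 (coprime? 0 M) + Σ< g m       ≡⟨ Σ<-suc (λ r → 𝟙 (coprime? r M)) m ⟨
  Σ< (λ r → 𝟙 (coprime? r M)) M  ∎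
  where
  open ≡-Reasoning
  g = λ a → 𝟙 (coprime? (suc a) M)
  M⊥M⇔0⊥M : Coprime M M ⇔ Coprime 0 M
  M⊥M⇔0⊥M = mk⇔ (λ c {d} (_ , d∣M) → c (d∣M , d∣M)) (λ c {d} (d∣M , _) → c (d ∣0 , d∣M))

ordCount-zero : ∀ M .{{_ : NonZero M}} → ordCount M 0 ≡ 1
ordCount-zero M@(suc m) = begin
  Σ< (λ x → 𝟙 (M ∣? x)) (suc (m * 1))              ≡⟨ Σ<-suc (λ x → 𝟙 (M ∣? x)) (m * 1) ⟩
  𝟙 (M ∣? 0) + Σ< (λ x → 𝟙 (M ∣? suc x)) (m * 1)   ≡⟨ cong₂ _+_ (𝟙-yes (M ∣? 0) (M ∣0)) (Σ<-zero M∤1+x) ⟩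
  1                                                ∎
  where
  open ≡-Reasoning
  M∤1+x : ∀ x → x < m * 1 → 𝟙 (M ∣? suc x) ≡ 0
  M∤1+x x x<m = 𝟙-no (M ∣? suc x) λ M∣1+x →
    <⇒≱ (<-≤-trans (s<s x<m) (≤-reflexive (*-identityʳ M))) (∣⇒≤ M∣1+x)

ordCount-one : ∀ n → ordCount 1 (suc n) ≡ 0
ordCount-one n = Σ<-zero λ x _ → 𝟙-no (hasOrd? 1 (suc n) x) (¬hasOrd-1 n x)

module _ (M : ℕ) .{{_ : NonZero M}} (1<M : 1 < M) (n : ℕ) where

  private
    N = M ^ suc n
    instance
      N≢0 : NonZero N
      N≢0 = m^n≢0 M (suc n)

    ¬coprime-multiple : ∀ {y} → Coprime y M → ¬ M ∣ y
    ¬coprime-multiple y⊥M M∣y = <⇒≢ 1<M (sym (y⊥M (M∣y , ∣-refl)))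

  module _ {r : ℕ} (r⊥M : Coprime r M) (r<M : r < M) where

    private
      0<r : 0 < r
      0<r = n≢0⇒n>0 λ { refl → ¬coprime-multiple r⊥M (M ∣0) }

      χℕ-residue : ∀ q → χℕ M (q * M + r) ≡ (q * M + r) * suc q
      χℕ-residue q = cong ((q * M + r) *_) (⌈⌉-block M q r 0<r (<⇒≤ r<M))

      χℕ-residue-shift : ∀ q d → χℕ M ((q + d) * M + r) ≡ χℕ M (q * M + r) + d * ((q + q + d + 1) * M + r)
      χℕ-residue-shift q d = begin
        χℕ M ((q + d) * M + r)               ≡⟨ χℕ-residue (q + d) ⟩
        ((q + d) * M + r) * suc (q + d)      ≡⟨ expand q d M r ⟩
        (q * M + r) * suc q + d * w          ≡⟨ cong (_+ d * w) (χℕ-residue q) ⟨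
        χℕ M (q * M + r) + d * w             ∎
        where
        open ≡-Reasoning
        w = (q + q + d + 1) * M + r
        expand : ∀ q d M r →
                 ((q + d) * M + r) * suc (q + d) ≡ (q * M + r) * suc q + d * ((q + q + d + 1) * M + r)
        expand = solve-∀

      orbit : ℕ → ℕ
      orbit q = χℕ M (q * M + r) % N

      orbit-shift-injective : ∀ q d → q + d < N → orbit (q + d) ≡ orbit q → d ≡ 0
      orbit-shift-injective q zero _ _ = refl
      orbit-shift-injective q (suc d) q+d<N eq =
        contradiction (∣⇒≤ N∣d) (<⇒≱ (≤-<-trans (m≤n+m (suc d) q) q+d<N))
        where
        w = (q + q + suc d + 1) * M + r
        N⊥w : Coprime N w
        N⊥w = Coprime.sym (coprime-^ (Equivalence.from (coprime-shift (q + q + suc d + 1)) r⊥M) (suc n))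
        N∣d*w : N ∣ suc d * w
        N∣d*w = [m+n]%o≡m%o⇒o∣n (χℕ M (q * M + r)) (suc d * w) N
                  (trans (cong (_% N) (sym (χℕ-residue-shift q (suc d)))) eq)
        N∣d : N ∣ suc d
        N∣d = coprime-divisor N⊥w (subst (N ∣_) (*-comm (suc d) w) N∣d*w)

      orbit-injective-≤ : ∀ {a b} → a ≤ b → b < N → orbit b ≡ orbit a → b ≡ a
      orbit-injective-≤ {a} {b} a≤b b<N orbit-b≡orbit-a = begin
        b             ≡⟨ b≡a+d ⟩
        a + (b ∸ a)   ≡⟨ cong (a +_) (orbit-shift-injective a (b ∸ a) (subst (_< N) b≡a+d b<N)
                           (subst (λ x → orbit x ≡ orbit a) b≡a+d orbit-b≡orbit-a)) ⟩
        a + 0         ≡⟨ +-identityʳ a ⟩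
        a             ∎
        where
        open ≡-Reasoning
        b≡a+d = sym (m+[n∸m]≡n a≤b)

      orbit-injective : ∀ i j → i < N → j < N → orbit i ≡ orbit j → i ≡ j
      orbit-injective i j i<N j<N eq with ≤-total i j
      ... | inj₁ i≤j = sym (orbit-injective-≤ i≤j j<N (sym eq))
      ... | inj₂ j≤i = orbit-injective-≤ j≤i i<N eq

    coprimeOrdCount-residue :
      Σ< (λ q → 𝟙 (coprime? (q * M + r) M ×-dec hasOrd? M (suc n) (q * M + r))) N ≡ ordCount M n
    coprimeOrdCount-residue = begin
      Σ< (λ q → 𝟙 (coprime? (q * M + r) M ×-dec hasOrd? M (suc n) (q * M + r))) N
        ≡⟨ Σ<-cong (λ q _ → 𝟙-cong _ (hasOrd? M n (orbit q)) (lifted⇔orbit q)) ⟩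
      Σ< (λ q → 𝟙 (hasOrd? M n (orbit q))) N
        ≡⟨ Σ<-reindex (λ q _ → m%n<n _ N) orbit-injective (λ x → 𝟙 (hasOrd? M n x)) ⟩
      ordCount M n
        ∎
      where
      open ≡-Reasoning
      lifted⇔orbit : ∀ q → (Coprime (q * M + r) M × HasOrd M (suc n) (q * M + r)) ⇔ HasOrd M n (orbit q)
      lifted⇔orbit q = mk⇔ (λ (_ , _ , ord) → Equivalence.to reduce ord) lift
        where
        y⊥M : Coprime (q * M + r) M
        y⊥M = Equivalence.from (coprime-shift q) r⊥M
        reduce : HasOrd M n (χℕ M (q * M + r)) ⇔ HasOrd M n (orbit q)
        reduce = subst (λ x → HasOrd M n x ⇔ HasOrd M n (orbit q)) (sym (m≡m%n+[m/n]*n (χℕ M (q * M + r)) N))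
                   (hasOrd-periodic M n (orbit q) (χℕ M (q * M + r) ℕ./ N))
        lift : HasOrd M n (orbit q) → Coprime (q * M + r) M × HasOrd M (suc n) (q * M + r)
        lift ord = y⊥M , ¬coprime-multiple y⊥M , Equivalence.from reduce ord

  coprimeOrdCount-suc : coprimeOrdCount M (suc n) ≡ φ M * ordCount M n
  coprimeOrdCount-suc = begin
    Σ< F (M * N)                                    ≡⟨ cong (Σ< F) (*-comm M N) ⟩
    Σ< F (N * M)                                    ≡⟨ Σ<-blocks F N M ⟩
    Σ< (λ q → Σ< (λ r → F (q * M + r)) M) N         ≡⟨ Σ<-comm (λ q r → F (q * M + r)) N M ⟩
    Σ< (λ r → Σ< (λ q → F (q * M + r)) N) M         ≡⟨ Σ<-cong residue ⟩
    Σ< (λ r → 𝟙 (coprime? r M) * ordCount M n) M    ≡⟨ Σ<-*ʳ (ordCount M n) (λ r → 𝟙 (coprime? r M)) ⟩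
    Σ< (λ r → 𝟙 (coprime? r M)) M * ordCount M n    ≡⟨ cong (_* ordCount M n) (φ≡Σ<coprime M) ⟨
    φ M * ordCount M n                              ∎
    where
    open ≡-Reasoning
    F : ℕ → ℕ
    F x = 𝟙 (coprime? x M ×-dec hasOrd? M (suc n) x)
    residue : ∀ r → r < M → Σ< (λ q → F (q * M + r)) N ≡ 𝟙 (coprime? r M) * ordCount M n
    residue r r<M with coprime? r M
    ... | yes r⊥M = trans (coprimeOrdCount-residue r⊥M r<M) (sym (+-identityʳ (ordCount M n)))
    ... | no ¬r⊥M = Σ<-zero λ q _ → 𝟙-no (coprime? (q * M + r) M ×-dec _)
                      λ (y⊥M , _) → ¬r⊥M (Equivalence.to (coprime-shift q) y⊥M)

module _ {p : ℕ} (p-prime : Prime p) where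

  private
    instance
      p≢0 : NonZero p
      p≢0 = prime⇒nonZero p-prime

    1<p : 1 < p
    1<p = nonTrivial⇒n>1 p {{prime⇒nonTrivial p-prime}}

    1<p^[1+k] : ∀ k → 1 < p ^ suc k
    1<p^[1+k] k = <-≤-trans 1<p (m≤m*n p (p ^ k) {{m^n≢0 p k}})

  coprime-prime^⇔ : ∀ {x} k → Coprime x (p ^ suc k) ⇔ (¬ p ∣ x)
  coprime-prime^⇔ {x} k = mk⇔ p∤x (λ p∤x → coprime-^ (x⊥p p∤x) (suc k))
    where
    p∤x : Coprime x (p ^ suc k) → ¬ p ∣ x
    p∤x x⊥p^[1+k] p∣x = <⇒≢ 1<p (sym (x⊥p^[1+k] (p∣x , m∣m*n (p ^ k))))

    x⊥p : ¬ p ∣ x → Coprime x p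
    x⊥p p∤x {d} (d∣x , d∣p) with prime⇒irreducible p-prime d∣p
    ... | inj₁ d≡1 = d≡1
    ... | inj₂ refl = contradiction d∣x p∤x

  φ-prime^ : ∀ k → φ (p ^ suc (suc k)) ≡ p * φ (p ^ suc k)
  φ-prime^ k = begin
    φ (p * P)                                     ≡⟨ φ≡Σ<coprime (p * P) ⟩
    Σ< (λ x → 𝟙 (coprime? x (p * P))) (p * P)   ≡⟨ Σ<-cong (λ x _ → 𝟙-cong _ _ same-units) ⟩
    Σ< (λ x → 𝟙 (coprime? x P)) (p * P)         ≡⟨ Σ<-periodic _ P periodic p ⟩
    p * Σ< (λ x → 𝟙 (coprime? x P)) P           ≡⟨ cong (p *_) (φ≡Σ<coprime P) ⟨
    p * φ P                                       ∎
    where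
    open ≡-Reasoning
    P = p ^ suc k
    same-units : ∀ {x} → Coprime x (p * P) ⇔ Coprime x P
    same-units = ⇔.trans (coprime-prime^⇔ (suc k)) (⇔.sym (coprime-prime^⇔ k))
    periodic : ∀ x → 𝟙 (coprime? (x + P) P) ≡ 𝟙 (coprime? x P)
    periodic x = 𝟙-cong _ _ (⇔.trans (coprime-prime^⇔ k) (⇔.trans (¬-cong-⇔ p∣x+P⇔p∣x) (⇔.sym (coprime-prime^⇔ k))))
      where
      p∣x+P⇔p∣x : (p ∣ x + P) ⇔ (p ∣ x)
      p∣x+P⇔p∣x = subst (λ y → (p ∣ x + y) ⇔ (p ∣ x)) (+-identityʳ P) (∣-shift 1 (m∣m*n (p ^ k)))

  ordCount-prime^-suc : ∀ k n → let instance _ = m^n≢0 p k; _ = m^n≢0 p (suc k) in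
    ordCount (p ^ suc k) n ≡ coprimeOrdCount (p ^ suc k) n + p ^ n * ordCount (p ^ k) n
  ordCount-prime^-suc k n = begin
    Σ< (λ x → 𝟙 (hasOrd? M n x)) N
      ≡⟨ Σ<-cong (λ x _ → 𝟙-split (p ∣? x) (hasOrd? M n x)) ⟩
    Σ< (λ x → 𝟙 (¬? (p ∣? x) ×-dec hasOrd? M n x) + G x) N
      ≡⟨ Σ<-distrib-+ (λ x → 𝟙 (¬? (p ∣? x) ×-dec hasOrd? M n x)) G ⟩
    Σ< (λ x → 𝟙 (¬? (p ∣? x) ×-dec hasOrd? M n x)) N + Σ< G N
      ≡⟨ cong₂ _+_ (Σ<-cong λ x _ → 𝟙-cong _ _ (⇔.sym (coprime-prime^⇔ k) ×-⇔ ⇔.refl)) multiples ⟩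
    coprimeOrdCount M n + p ^ n * ordCount M′ n
      ∎
    where
    open ≡-Reasoning
    M = p ^ suc k
    M′ = p ^ k
    instance
      M≢0 : NonZero M
      M≢0 = m^n≢0 p (suc k)
      M′≢0 : NonZero M′
      M′≢0 = m^n≢0 p k
    N = M ^ suc n
    R = p ^ n * M′ ^ suc n
    G : ℕ → ℕ
    G x = 𝟙 (p ∣? x ×-dec hasOrd? M n x)

    N≡R*p : N ≡ R * p
    N≡R*p = trans (^-distribʳ-* p M′ (suc n)) (*-CS.xy∙z≈yz∙x p (p ^ n) (M′ ^ suc n))

    multiple : ∀ y → G (y * p + 0) ≡ 𝟙 (hasOrd? M′ n y)
    multiple y = 𝟙-cong _ _
      (mk⇔ (λ (_ , ord) → Equivalence.to scaled ord) (λ ord → p∣y*p , Equivalence.from scaled ord))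
      where
      y*p+0≡p*y = trans (+-identityʳ (y * p)) (*-comm y p)
      p∣y*p = subst (p ∣_) (sym y*p+0≡p*y) (m∣m*n y)
      scaled : HasOrd M n (y * p + 0) ⇔ HasOrd M′ n y
      scaled = subst (λ x → HasOrd M n x ⇔ HasOrd M′ n y) (sym y*p+0≡p*y) (hasOrd-scale p M′ n y)

    nonmultiple : ∀ y r → suc r < p → G (y * p + suc r) ≡ 0
    nonmultiple y r 1+r<p = 𝟙-no (p ∣? (y * p + suc r) ×-dec _) λ (p∣y*p+1+r , _) →
      <⇒≱ 1+r<p (∣⇒≤ (Equivalence.to (∣-shift y ∣-refl) (subst (p ∣_) (+-comm (y * p) (suc r)) p∣y*p+1+r)))

    block : ∀ y → Σ< (λ r → G (y * p + r)) p ≡ 𝟙 (hasOrd? M′ n y)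
    block y = trans (Σ<-≡-head (<-trans z<s 1<p) (nonmultiple y)) (multiple y)

    multiples : Σ< G N ≡ p ^ n * ordCount M′ n
    multiples = begin
      Σ< G N                                          ≡⟨ cong (Σ< G) N≡R*p ⟩
      Σ< G (R * p)                                    ≡⟨ Σ<-blocks G R p ⟩
      Σ< (λ y → Σ< (λ r → G (y * p + r)) p) R         ≡⟨ Σ<-cong (λ y _ → block y) ⟩
      Σ< (λ y → 𝟙 (hasOrd? M′ n y)) (p ^ n * M′ ^ suc n) ≡⟨ Σ<-periodic _ (M′ ^ suc n) periodic (p ^ n) ⟩
      p ^ n * ordCount M′ n                           ∎
      where
      periodic : ∀ y → 𝟙 (hasOrd? M′ n (y + M′ ^ suc n)) ≡ 𝟙 (hasOrd? M′ n y)
      periodic y = 𝟙-cong _ _ (subst (λ x → HasOrd M′ n (y + x) ⇔ HasOrd M′ n y) (+-identityʳ (M′ ^ suc n))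
                                  (hasOrd-periodic M′ n y 1))

  private
    [n+0]C[1+n]≡0 : ∀ n → (n + 0) C suc n ≡ 0
    [n+0]C[1+n]≡0 n = k>n⇒nCk≡0 (s≤s (≤-reflexive (+-identityʳ n)))

    absorb-p^[1+n] : ∀ n k →
      p ^ suc n * (((n + k) C suc n) * φ (p ^ k) ^ suc n) ≡ ((n + k) C suc n) * φ (p ^ suc k) ^ suc n
    absorb-p^[1+n] n zero = begin
      p ^ suc n * (((n + 0) C suc n) * φ 1 ^ suc n)  ≡⟨ cong (λ c → p ^ suc n * (c * φ 1 ^ suc n))
                                                           ([n+0]C[1+n]≡0 n) ⟩
      p ^ suc n * 0                                  ≡⟨ *-zeroʳ (p ^ suc n) ⟩
      0                                              ≡⟨ cong (_* φ (p ^ 1) ^ suc n) ([n+0]C[1+n]≡0 n) ⟨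
      ((n + 0) C suc n) * φ (p ^ 1) ^ suc n          ∎
      where open ≡-Reasoning
    absorb-p^[1+n] n (suc k) = begin
      p ^ suc n * (c * φ (p ^ suc k) ^ suc n)   ≡⟨ *-CS.x∙yz≈y∙xz (p ^ suc n) c _ ⟩
      c * (p ^ suc n * φ (p ^ suc k) ^ suc n)   ≡⟨ cong (c *_) (^-distribʳ-* p (φ (p ^ suc k)) (suc n)) ⟨
      c * (p * φ (p ^ suc k)) ^ suc n            ≡⟨ cong (λ x → c * x ^ suc n) (φ-prime^ k) ⟨
      c * φ (p ^ suc (suc k)) ^ suc n            ∎
      where
      open ≡-Reasoning
      c = (n + suc k) C suc n

  ordCount-prime^ : ∀ n k → let instance _ = m^n≢0 p k in
    ordCount (p ^ k) n ≡ ((n + k ∸ 1) C n) * φ (p ^ k) ^ n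
  coprimeOrdCount-prime^ : ∀ k n → let instance _ = m^n≢0 p (suc k) in
    coprimeOrdCount (p ^ suc k) (suc n) ≡ ((n + suc k ∸ 1) C n) * φ (p ^ suc k) ^ suc n

  ordCount-prime^ zero k = ordCount-zero (p ^ k) {{m^n≢0 p k}}
  ordCount-prime^ (suc n) zero = trans (ordCount-one n) (sym (cong (_* φ 1 ^ suc n) ([n+0]C[1+n]≡0 n)))
  ordCount-prime^ (suc n) (suc k) = begin
    ordCount (p ^ suc k) (suc n)
      ≡⟨ ordCount-prime^-suc k (suc n) ⟩
    coprimeOrdCount (p ^ suc k) (suc n) + p ^ suc n * ordCount (p ^ k) (suc n)
      ≡⟨ cong₂ _+_ (coprimeOrdCount-prime^ k n) (cong (p ^ suc n *_) (ordCount-prime^ (suc n) k)) ⟩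
    ((n + suc k ∸ 1) C n) * Φ ^ suc n + p ^ suc n * (((n + k) C suc n) * φ (p ^ k) ^ suc n)
      ≡⟨ cong₂ _+_ (cong (λ m → ((m ∸ 1) C n) * Φ ^ suc n) (+-suc n k)) (absorb-p^[1+n] n k) ⟩
    ((n + k) C n) * Φ ^ suc n + ((n + k) C suc n) * Φ ^ suc n
      ≡⟨ *-distribʳ-+ (Φ ^ suc n) ((n + k) C n) ((n + k) C suc n) ⟨
    ((n + k) C n + (n + k) C suc n) * Φ ^ suc n
      ≡⟨ cong (_* Φ ^ suc n) (nCk+nC[k+1]≡[n+1]C[k+1] (n + k) n) ⟩
    (suc (n + k) C suc n) * Φ ^ suc n
      ≡⟨ cong (λ m → (m C suc n) * Φ ^ suc n) (+-suc n k) ⟨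
    ((n + suc k) C suc n) * Φ ^ suc n
      ∎
    where
    open ≡-Reasoning
    instance
      p^k≢0 : NonZero (p ^ k)
      p^k≢0 = m^n≢0 p k
      p^[1+k]≢0 : NonZero (p ^ suc k)
      p^[1+k]≢0 = m^n≢0 p (suc k)
    Φ = φ (p ^ suc k)

  coprimeOrdCount-prime^ k n = begin
    coprimeOrdCount (p ^ suc k) (suc n)     ≡⟨ coprimeOrdCount-suc (p ^ suc k) (1<p^[1+k] k) n ⟩
    Φ * ordCount (p ^ suc k) n              ≡⟨ cong (Φ *_) (ordCount-prime^ n (suc k)) ⟩
    Φ * (((n + suc k ∸ 1) C n) * Φ ^ n)     ≡⟨ *-CS.x∙yz≈y∙xz Φ ((n + suc k ∸ 1) C n) (Φ ^ n) ⟩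
    ((n + suc k ∸ 1) C n) * Φ ^ suc n       ∎
    where
    open ≡-Reasoning
    instance
      p^[1+k]≢0 : NonZero (p ^ suc k)
      p^[1+k]≢0 = m^n≢0 p (suc k)
    Φ = φ (p ^ suc k)

corollary2p5 : (p : ℕ) → Prime p → (k n : ℕ) → 1 ≤ k → 1 ≤ n →
    A n (p ^ k) ≡ ((n + k ∸ 2) C (n ∸ 1)) * φ (p ^ k) ^ n
corollary2p5 p p-prime (suc k) (suc n) _ _ =
  trans (A≡coprimeOrdCount (suc n) (p ^ suc k) {{p^[1+k]≢0}}) (coprimeOrdCount-prime^ p-prime k n)
  where
  p^[1+k]≢0 : NonZero (p ^ suc k)
  p^[1+k]≢0 = m^n≢0 p (suc k) {{prime⇒nonZero p-prime}}
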